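{- Let $G$ be a connected graph in $\mathcal{C}_{\le 3}$. Then $G$ contains no member of $\mathcal{F}$ as an induced subgraph.
   Context: For a simple graph $G$ on $n$ vertices, $A_k(G,t)$ is the ideal of $\mathbb{Z}[t]$ generated by the $k\times k$ minors of $tI_n-A(G)$; it is trivial if it equals $\mathbb{Z}[t]$. $\gamma_A(G)$ is the largest $k$ with $A_k(G,t)$ trivial, and $\mathcal{C}_{\le k}$ is the family of graphs with $\gamma_A(G)\le k$. $\mathcal{F}$ is the set of 14 graphs: the fork (star $K_{1,3}$ with one edge subdivided once); the 4-pan ($C_4$ with a pendant vertex); the bull (triangle with pendant vertices at two distinct triangle vertices); the dart $K_1\vee(P_3+K_1)$; $P_5$; the co-4-pan (triangle with a path of length 2 attached at one triangle vertex); the 3-fan $K_1\vee P_4$; the kite (diamond $K_4-e$ with a pendant vertex at one of its degree-2 vertices); $K_1\vee(K_2+3K_1)$; $2K_1\vee(K_2+2K_1)$; $3K_1\vee(K_2+K_1)$; $P_3\vee(K_2+K_1)$; $K_{1,1,1,2,2}$; $K_{1,1,1,1,4}$. Here $\vee$ is join, $+$ disjoint union, $mK_1$ the edgeless graph on $m$ vertices. -}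

module Defs where

open import Data.Bool using (Bool; true; false; not; _∧_; _∨_; if_then_else_)
open import Data.Bool.Properties using (∨-comm)
open import Data.Nat using (ℕ; zero; suc; _≡ᵇ_; _<_)
open import Data.Integer using (ℤ; +_; -[1+_]) renaming (_+_ to _+ℤ_; _*_ to _*ℤ_; -_ to -ℤ_)
open import Data.Fin using (Fin; toℕ; punchIn) renaming (zero to fzero; suc to fsuc; _<_ to _<ᶠ_)
open import Data.List using (List; []; _∷_; map; foldr)
open import Data.Bool.ListAction using (any)
open import Data.Product using (Σ; _×_; _,_; ∃)
open import Relation.Binary.PropositionalEquality using (_≡_; refl; cong; cong₂)
open import Relation.Nullary using (¬_)
open import Function.Definitions using (Injective)

-- Polynomials in ℤ[t]: coefficient lists, lowest degree first.

Poly : Set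
Poly = List ℤ

infixl 6 _⊕_
infixl 7 _⊗_

_⊕_ : Poly → Poly → Poly
[] ⊕ q = q
(a ∷ p) ⊕ [] = a ∷ p
(a ∷ p) ⊕ (b ∷ q) = (a +ℤ b) ∷ (p ⊕ q)

scale : ℤ → Poly → Poly
scale a = map (a *ℤ_)

_⊗_ : Poly → Poly → Poly
[] ⊗ q = []
(a ∷ p) ⊗ q = scale a q ⊕ ((+ 0) ∷ (p ⊗ q))

coeff : Poly → ℕ → ℤ
coeff [] _ = + 0
coeff (a ∷ p) zero = a
coeff (a ∷ p) (suc i) = coeff p i

-- equality of polynomials (ignores trailing zero coefficients)
_≈P_ : Poly → Poly → Set
p ≈P q = ∀ i → coeff p i ≡ coeff q i

0P 1P -1P tP : Poly
0P = []
1P = (+ 1) ∷ []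
-1P = -[1+ 0 ] ∷ []
tP = (+ 0) ∷ (+ 1) ∷ []

sumFin : ∀ {k} → (Fin k → Poly) → Poly
sumFin {zero} f = 0P
sumFin {suc k} f = f fzero ⊕ sumFin (λ j → f (fsuc j))

signP : ∀ {k} → Fin k → Poly
signP j = go (toℕ j)
  where
  go : ℕ → Poly
  go zero = 1P
  go (suc zero) = -1P
  go (suc (suc m)) = go m

det : ∀ k → (Fin k → Fin k → Poly) → Poly
det zero M = 1P
det (suc k) M =
  sumFin (λ j → signP j ⊗ (M fzero j ⊗ det k (λ r c → M (fsuc r) (punchIn j c))))

record Graph : Set where
  field
    n       : ℕ
    adj     : Fin n → Fin n → Bool
    adj-sym : ∀ i j → adj i j ≡ adj j i
    adj-irr : ∀ i → adj i i ≡ false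
open Graph public

charMat : (G : Graph) → Fin (n G) → Fin (n G) → Poly
charMat G i j =
  if toℕ i ≡ᵇ toℕ j then tP else (if adj G i j then -1P else 0P)

-- strictly increasing choice of k indices out of n (a k-subset)
Increasing : ∀ {k m} → (Fin k → Fin m) → Set
Increasing f = ∀ i j → i <ᶠ j → f i <ᶠ f j

record MinorTerm (G : Graph) (k : ℕ) : Set where
  field
    rows    : Fin k → Fin (n G)
    cols    : Fin k → Fin (n G)
    rowsInc : Increasing rows
    colsInc : Increasing cols
    coef    : Poly
open MinorTerm public

minor : (G : Graph) (k : ℕ) → (Fin k → Fin (n G)) → (Fin k → Fin (n G)) → Poly
minor G k r c = det k (λ a b → charMat G (r a) (c b))

combination : (G : Graph) (k : ℕ) → List (MinorTerm G k) → Poly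
combination G k = foldr (λ m acc → coef m ⊗ minor G k (rows m) (cols m) ⊕ acc) 0P

-- A_k(G,t) is trivial: 1 lies in the ideal generated by the k×k minors
TrivialA : Graph → ℕ → Set
TrivialA G k = Σ (List (MinorTerm G k)) λ L → combination G k L ≈P 1P

-- γ_A(G) ≤ k : no j > k has A_j(G,t) trivial
InC≤ : ℕ → Graph → Set
InC≤ k G = ∀ j → k < j → ¬ TrivialA G j

data Walk (G : Graph) : Fin (n G) → Fin (n G) → Set where
  here : ∀ {u} → Walk G u u
  step : ∀ {u w v} → adj G u w ≡ true → Walk G w v → Walk G u v

Connected : Graph → Set
Connected G = ∀ u v → Walk G u v

InducedSub : Graph → Graph → Set
InducedSub H G =
  Σ (Fin (n H) → Fin (n G)) λ f →
    Injective _≡_ _≡_ f × (∀ i j → adj G (f i) (f j) ≡ adj H i j)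

hasE : List (ℕ × ℕ) → ℕ → ℕ → Bool
hasE es a b = any (λ { (x , y) → (x ≡ᵇ a) ∧ (y ≡ᵇ b) }) es

mkAdj : ∀ {m} → List (ℕ × ℕ) → Fin m → Fin m → Bool
mkAdj es i j = not (toℕ i ≡ᵇ toℕ j) ∧ (hasE es (toℕ i) (toℕ j) ∨ hasE es (toℕ j) (toℕ i))

≡ᵇ-sym : ∀ a b → (a ≡ᵇ b) ≡ (b ≡ᵇ a)
≡ᵇ-sym zero zero = refl
≡ᵇ-sym zero (suc b) = refl
≡ᵇ-sym (suc a) zero = refl
≡ᵇ-sym (suc a) (suc b) = ≡ᵇ-sym a b

≡ᵇ-refl : ∀ a → (a ≡ᵇ a) ≡ true
≡ᵇ-refl zero = refl
≡ᵇ-refl (suc a) = ≡ᵇ-refl a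

mkAdj-sym : ∀ {m} es (i j : Fin m) → mkAdj es i j ≡ mkAdj es j i
mkAdj-sym es i j =
  cong₂ _∧_ (cong not (≡ᵇ-sym (toℕ i) (toℕ j)))
            (∨-comm (hasE es (toℕ i) (toℕ j)) (hasE es (toℕ j) (toℕ i)))

mkAdj-irr : ∀ {m} es (i : Fin m) → mkAdj es i i ≡ false
mkAdj-irr es i with toℕ i ≡ᵇ toℕ i | ≡ᵇ-refl (toℕ i)
... | true | _ = refl

mkGraph : ℕ → List (ℕ × ℕ) → Graph
mkGraph m es = record
  { n = m ; adj = mkAdj es ; adj-sym = mkAdj-sym es ; adj-irr = mkAdj-irr es }

fork : Graph   -- K_{1,3} with edge 0-3 subdivided by 4
fork = mkGraph 5 ((0 , 1) ∷ (0 , 2) ∷ (0 , 4) ∷ (4 , 3) ∷ [])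

pan4 : Graph   -- C4 0-1-2-3-0 with pendant 4 at 0
pan4 = mkGraph 5 ((0 , 1) ∷ (1 , 2) ∷ (2 , 3) ∷ (3 , 0) ∷ (0 , 4) ∷ [])

bull : Graph   -- triangle 0,1,2 with pendants 3 at 0 and 4 at 1
bull = mkGraph 5 ((0 , 1) ∷ (1 , 2) ∷ (0 , 2) ∷ (0 , 3) ∷ (1 , 4) ∷ [])

dart : Graph   -- K1 (0) ∨ (P3 1-2-3 + K1 4)
dart = mkGraph 5 ((0 , 1) ∷ (0 , 2) ∷ (0 , 3) ∷ (0 , 4) ∷ (1 , 2) ∷ (2 , 3) ∷ [])

P5 : Graph
P5 = mkGraph 5 ((0 , 1) ∷ (1 , 2) ∷ (2 , 3) ∷ (3 , 4) ∷ [])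

co4pan : Graph -- triangle 0,1,2 with path 0-3-4
co4pan = mkGraph 5 ((0 , 1) ∷ (1 , 2) ∷ (0 , 2) ∷ (0 , 3) ∷ (3 , 4) ∷ [])

fan3 : Graph   -- K1 (0) ∨ P4 1-2-3-4
fan3 = mkGraph 5 ((0 , 1) ∷ (0 , 2) ∷ (0 , 3) ∷ (0 , 4) ∷ (1 , 2) ∷ (2 , 3) ∷ (3 , 4) ∷ [])

kite : Graph   -- diamond on 0,1,2,3 (non-edge 2-3), pendant 4 at degree-2 vertex 2
kite = mkGraph 5 ((0 , 1) ∷ (0 , 2) ∷ (0 , 3) ∷ (1 , 2) ∷ (1 , 3) ∷ (2 , 4) ∷ [])

F9 : Graph     -- K1 (0) ∨ (K2 1-2 + 3K1 {3,4,5})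
F9 = mkGraph 6 ((0 , 1) ∷ (0 , 2) ∷ (0 , 3) ∷ (0 , 4) ∷ (0 , 5) ∷ (1 , 2) ∷ [])

F10 : Graph    -- 2K1 {0,1} ∨ (K2 2-3 + 2K1 {4,5})
F10 = mkGraph 6 ((0 , 2) ∷ (0 , 3) ∷ (0 , 4) ∷ (0 , 5) ∷
                 (1 , 2) ∷ (1 , 3) ∷ (1 , 4) ∷ (1 , 5) ∷ (2 , 3) ∷ [])

F11 : Graph    -- 3K1 {0,1,2} ∨ (K2 3-4 + K1 5)
F11 = mkGraph 6 ((0 , 3) ∷ (0 , 4) ∷ (0 , 5) ∷ (1 , 3) ∷ (1 , 4) ∷ (1 , 5) ∷
                 (2 , 3) ∷ (2 , 4) ∷ (2 , 5) ∷ (3 , 4) ∷ [])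

F12 : Graph    -- P3 0-1-2 ∨ (K2 3-4 + K1 5)
F12 = mkGraph 6 ((0 , 1) ∷ (1 , 2) ∷
                 (0 , 3) ∷ (0 , 4) ∷ (0 , 5) ∷ (1 , 3) ∷ (1 , 4) ∷ (1 , 5) ∷
                 (2 , 3) ∷ (2 , 4) ∷ (2 , 5) ∷ (3 , 4) ∷ [])

K11122 : Graph -- parts {0},{1},{2},{3,4},{5,6}
K11122 = mkGraph 7 ((0 , 1) ∷ (0 , 2) ∷ (0 , 3) ∷ (0 , 4) ∷ (0 , 5) ∷ (0 , 6) ∷
                    (1 , 2) ∷ (1 , 3) ∷ (1 , 4) ∷ (1 , 5) ∷ (1 , 6) ∷
                    (2 , 3) ∷ (2 , 4) ∷ (2 , 5) ∷ (2 , 6) ∷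
                    (3 , 5) ∷ (3 , 6) ∷ (4 , 5) ∷ (4 , 6) ∷ [])

K11114 : Graph -- parts {0},{1},{2},{3},{4,5,6,7}
K11114 = mkGraph 8 ((0 , 1) ∷ (0 , 2) ∷ (0 , 3) ∷ (0 , 4) ∷ (0 , 5) ∷ (0 , 6) ∷ (0 , 7) ∷
                    (1 , 2) ∷ (1 , 3) ∷ (1 , 4) ∷ (1 , 5) ∷ (1 , 6) ∷ (1 , 7) ∷
                    (2 , 3) ∷ (2 , 4) ∷ (2 , 5) ∷ (2 , 6) ∷ (2 , 7) ∷
                    (3 , 4) ∷ (3 , 5) ∷ (3 , 6) ∷ (3 , 7) ∷ [])

familyF : List Graph
familyF = fork ∷ pan4 ∷ bull ∷ dart ∷ P5 ∷ co4pan ∷ fan3 ∷ kite ∷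
          F9 ∷ F10 ∷ F11 ∷ F12 ∷ K11122 ∷ K11114 ∷ []

-- Every H ∈ 𝓕 has one or two 4×4 minors of tI − A(H) that combine over ℤ[t] to 1. If H is
-- an induced subgraph of G, each of these minors reappears as a 4×4 minor of tI − A(G), but
-- with its rows and columns in the order imposed by G's vertex numbering, hence up to the sign
-- of that reordering. So A₄(G,t) is trivial and γ_A(G) ≥ 4. Rather than proving that the
-- determinant is alternating, the certificates are checked by evaluation for every reordering.
module Submission where

open import Defs
open import Data.List.Membership.Propositional using (_∈_)
open import Relation.Nullary using (¬_)

open import Agda.Builtin.FromNat using (Number; fromNat)
open import Agda.Builtin.FromNeg using (Negative; fromNeg)
open import Data.Bool using (if_then_else_)
open import Data.Empty using (⊥-elim)
open import Data.Unit using (tt) -- instance solving the trivial constraints of ℕ and ℤ literals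
open import Data.Fin using (Fin; toℕ; punchIn; punchOut; _<?_) renaming (zero to fzero; suc to fsuc)
import Data.Fin.Literals as Fin
import Data.Fin.Properties as Fin
open import Data.Integer using (ℤ; +_; -[1+_]) renaming (_+_ to _+ℤ_)
import Data.Integer.Literals as ℤ
import Data.Integer.Properties as ℤ
open import Data.List using (List; []; _∷_; foldr; map; concatMap; allFin)
open import Data.List.Properties using (≡-dec)
open import Data.List.Membership.Propositional.Properties
  using (∈-concatMap⁺; ∈-map⁺; ∈-allFin)
open import Data.List.Relation.Unary.All as All using (All; []; _∷_; all?)
open import Data.List.Relation.Unary.Any as Any using (here)
open import Data.Nat using (ℕ; zero; suc; _+_; _≡ᵇ_; z≤n; s≤s)
import Data.Nat.Literals as ℕ
import Data.Nat.Properties as ℕ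
open import Data.Product using (Σ; _×_; _,_; proj₁; proj₂)
import Data.Vec as Vec
open import Data.Vec using (Vec; []; _∷_; lookup; count)
open import Data.Vec.Properties using (lookup-map)
open import Data.Vec.Relation.Unary.AllPairs using (allPairs?)
open import Data.Vec.Relation.Unary.Unique.Propositional using (Unique)
open import Data.Vec.Relation.Unary.Unique.Propositional.Properties using (lookup-injective)
open import Function.Base using (_∘_)
open import Function.Bundles using (mk⇔)
open import Function.Definitions using (Injective)
open import Relation.Binary.Definitions using (tri<; tri≈; tri>)
open import Relation.Binary.PropositionalEquality
open import Relation.Nullary using (Dec; yes; no; ¬?; _×-dec_)
open import Relation.Nullary.Decidable using (True; toWitness; does-⇔)

instance
  ℕ-number : Number ℕ
  ℕ-number = ℕ.number

  ℤ-number : Number ℤ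
  ℤ-number = ℤ.number

  ℤ-negative : Negative ℤ
  ℤ-negative = ℤ.negative

  Fin-number : ∀ {m} → Number (Fin m)
  Fin-number {m} = Fin.number m

private
  variable
    k N : ℕ
    H G : Graph

-- Polynomials modulo trailing zeros

infixr 5 _∷ᵗ_
infix 4 _≐_ _≐?_

_∷ᵗ_ : ℤ → Poly → Poly
a ∷ᵗ (b ∷ p) = a ∷ b ∷ p
+ zero ∷ᵗ [] = []
+ suc m ∷ᵗ [] = + suc m ∷ []
-[1+ m ] ∷ᵗ [] = -[1+ m ] ∷ []

trim : Poly → Poly
trim [] = []
trim (a ∷ p) = a ∷ᵗ trim p

_≐_ : Poly → Poly → Set
p ≐ q = trim p ≡ trim q

_≐?_ : ∀ p q → Dec (p ≐ q)
p ≐? q = ≡-dec ℤ._≟_ (trim p) (trim q)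

coeff-∷ᵗ : ∀ a p i → coeff (a ∷ᵗ p) i ≡ coeff (a ∷ p) i
coeff-∷ᵗ a (b ∷ p) i = refl
coeff-∷ᵗ (+ zero) [] zero = refl
coeff-∷ᵗ (+ zero) [] (suc i) = refl
coeff-∷ᵗ (+ suc m) [] i = refl
coeff-∷ᵗ -[1+ m ] [] i = refl

coeff-trim : ∀ p i → coeff (trim p) i ≡ coeff p i
coeff-trim [] i = refl
coeff-trim (a ∷ p) zero = coeff-∷ᵗ a (trim p) zero
coeff-trim (a ∷ p) (suc i) = trans (coeff-∷ᵗ a (trim p) (suc i)) (coeff-trim p i)

≐⇒≈P : ∀ {p q} → p ≐ q → p ≈P q
≐⇒≈P {p} {q} p≐q i = begin
  coeff p i        ≡⟨ coeff-trim p i ⟨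
  coeff (trim p) i ≡⟨ cong (λ r → coeff r i) p≐q ⟩
  coeff (trim q) i ≡⟨ coeff-trim q i ⟩
  coeff q i        ∎
  where open ≡-Reasoning

≈P-trans : ∀ {p q r} → p ≈P q → q ≈P r → p ≈P r
≈P-trans p≈q q≈r i = trans (p≈q i) (q≈r i)

coeff-⊕ : ∀ p q i → coeff (p ⊕ q) i ≡ coeff p i +ℤ coeff q i
coeff-⊕ [] q i = sym (ℤ.+-identityˡ (coeff q i))
coeff-⊕ (a ∷ p) [] zero = sym (ℤ.+-identityʳ a)
coeff-⊕ (a ∷ p) [] (suc i) = sym (ℤ.+-identityʳ (coeff p i))
coeff-⊕ (a ∷ p) (b ∷ q) zero = refl
coeff-⊕ (a ∷ p) (b ∷ q) (suc i) = coeff-⊕ p q i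

⊕-cong : ∀ {p p′ q q′} → p ≈P p′ → q ≈P q′ → (p ⊕ q) ≈P (p′ ⊕ q′)
⊕-cong {p} {p′} {q} {q′} p≈p′ q≈q′ i = begin
  coeff (p ⊕ q) i          ≡⟨ coeff-⊕ p q i ⟩
  coeff p i +ℤ coeff q i   ≡⟨ cong₂ _+ℤ_ (p≈p′ i) (q≈q′ i) ⟩
  coeff p′ i +ℤ coeff q′ i ≡⟨ coeff-⊕ p′ q′ i ⟨
  coeff (p′ ⊕ q′) i        ∎
  where open ≡-Reasoning

sumFin-cong : ∀ {f g : Fin k → Poly} → (∀ j → f j ≡ g j) → sumFin f ≡ sumFin g
sumFin-cong {zero} f≗g = refl
sumFin-cong {suc k} f≗g = cong₂ _⊕_ (f≗g fzero) (sumFin-cong (λ j → f≗g (fsuc j)))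

det-cong : ∀ k {M M′ : Fin k → Fin k → Poly} → (∀ x y → M x y ≡ M′ x y) →
  det k M ≡ det k M′
det-cong zero M≗M′ = refl
det-cong (suc k) M≗M′ = sumFin-cong λ j →
  cong₂ (λ a d → signP j ⊗ (a ⊗ d))
        (M≗M′ fzero j) (det-cong k λ x y → M≗M′ (fsuc x) (punchIn j y))

-- Arrangements of Fin k and their signs

unique? : ∀ {m k} (v : Vec (Fin m) k) → Dec (Unique v)
unique? = allPairs? (λ x y → ¬? (x Fin.≟ y))

arrangements : ∀ k → List (Vec (Fin k) k)
arrangements zero = [] ∷ []
arrangements (suc k) =
  concatMap (λ v → map (λ i → i ∷ Vec.map (punchIn i) v) (allFin (suc k))) (arrangements k)

arrangement-of : ∀ {ρ : Fin k → Fin k} → Injective _≡_ _≡_ ρ →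
  Σ (Vec (Fin k) k) λ v → v ∈ arrangements k × (∀ x → lookup v x ≡ ρ x)
arrangement-of {zero} _ = [] , here refl , λ ()
arrangement-of {suc k} {ρ} ρ-inj = extend (arrangement-of ρ′-inj)
  where
  avoids : ∀ x → ρ fzero ≢ ρ (fsuc x)
  avoids x ρ0≡ρx with () ← ρ-inj ρ0≡ρx
  ρ′ : Fin k → Fin k
  ρ′ x = punchOut (avoids x)
  ρ′-inj : Injective _≡_ _≡_ ρ′
  ρ′-inj {x} {y} eq = Fin.suc-injective (ρ-inj (Fin.punchOut-injective (avoids x) (avoids y) eq))
  extend : Σ (Vec (Fin k) k) (λ v → v ∈ arrangements k × (∀ x → lookup v x ≡ ρ′ x)) →
    Σ (Vec (Fin (suc k)) (suc k)) λ v → v ∈ arrangements (suc k) × (∀ x → lookup v x ≡ ρ x)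
  extend (v , v∈ , v≗ρ′) =
    ρ fzero ∷ Vec.map (punchIn (ρ fzero)) v ,
    ∈-concatMap⁺ _ (Any.map (λ { refl → ∈-map⁺ _ (∈-allFin (ρ fzero)) }) v∈) ,
    λ { fzero → refl
      ; (fsuc x) → trans (lookup-map x _ v)
                     (trans (cong (punchIn (ρ fzero)) (v≗ρ′ x)) (Fin.punchIn-punchOut (avoids x))) }

inversions : ∀ {m k} → Vec (Fin m) k → ℕ
inversions [] = 0
inversions (x ∷ v) = count (_<? x) v + inversions v

-1^_ : ℕ → Poly
-1^ zero = 1P
-1^ suc m = -1P ⊗ (-1^ m)

sign : ∀ {m k} → Vec (Fin m) k → Poly
sign v = -1^ inversions v

record Sorting (g : Fin k → Fin N) : Set where
  field
    sorted : Fin k → Fin N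
    sorted-increasing : Increasing sorted
    order : Fin k → Fin k
    sorted≡g∘order : ∀ x → sorted x ≡ g (order x)

  order-injective : Injective _≡_ _≡_ order
  order-injective {x} {y} ox≡oy with Fin.<-cmp x y
  ... | tri< x<y _ _ = ⊥-elim (ℕ.<-irrefl (cong toℕ sx≡sy) (sorted-increasing x y x<y))
    where sx≡sy = trans (sorted≡g∘order x) (trans (cong g ox≡oy) (sym (sorted≡g∘order y)))
  ... | tri≈ _ x≡y _ = x≡y
  ... | tri> _ _ y<x = ⊥-elim (ℕ.<-irrefl (cong toℕ sy≡sx) (sorted-increasing y x y<x))
    where sy≡sx = trans (sorted≡g∘order y) (trans (cong g (sym ox≡oy)) (sym (sorted≡g∘order x)))

open Sorting

sorting-shift : ∀ {g : Fin k → Fin (suc N)} {g′ : Fin k → Fin N} →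
  (∀ x → g x ≡ fsuc (g′ x)) → Sorting g′ → Sorting g
sorting-shift g≗suc∘g′ s = record
  { sorted = λ x → fsuc (sorted s x)
  ; sorted-increasing = λ x y x<y → s≤s (sorted-increasing s x y x<y)
  ; order = order s
  ; sorted≡g∘order = λ x →
      trans (cong fsuc (sorted≡g∘order s x)) (sym (g≗suc∘g′ (order s x)))
  }

sorting-cons : ∀ {g : Fin (suc k) → Fin (suc N)} {g′ : Fin k → Fin N} (x₀ : Fin (suc k)) →
  g x₀ ≡ fzero → (∀ y → g (punchIn x₀ y) ≡ fsuc (g′ y)) → Sorting g′ → Sorting g
sorting-cons {k} {N} {g} {g′} x₀ gx₀≡0 g≗suc∘g′ s = record
  { sorted = sorted′ ; sorted-increasing = increasing ; order = order′ ; sorted≡g∘order = sorted≡ }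
  where
  sorted′ : Fin (suc k) → Fin (suc N)
  sorted′ fzero = fzero
  sorted′ (fsuc x) = fsuc (sorted s x)
  order′ : Fin (suc k) → Fin (suc k)
  order′ fzero = x₀
  order′ (fsuc x) = punchIn x₀ (order s x)
  increasing : Increasing sorted′
  increasing fzero (fsuc y) _ = s≤s z≤n
  increasing (fsuc x) (fsuc y) (s≤s x<y) = s≤s (sorted-increasing s x y x<y)
  sorted≡ : ∀ x → sorted′ x ≡ g (order′ x)
  sorted≡ fzero = sym gx₀≡0
  sorted≡ (fsuc x) = trans (cong fsuc (sorted≡g∘order s x)) (sym (g≗suc∘g′ (order s x)))

-- Peel off the least possible value 0: either it is hit (and goes first) or everything shifts down.
sort-injective : (g : Fin k → Fin N) → Injective _≡_ _≡_ g → Sorting g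
sort-injective {zero} g _ = record
  { sorted = λ () ; sorted-increasing = λ () ; order = λ () ; sorted≡g∘order = λ () }
sort-injective {suc k} {zero} g _ with g fzero
... | ()
sort-injective {suc k} {suc N} g g-inj with Fin.any? (λ x → g x Fin.≟ fzero)
... | yes (x₀ , gx₀≡0) =
  sorting-cons x₀ gx₀≡0 (λ y → sym (Fin.punchIn-punchOut (avoids y)))
    (sort-injective (λ y → punchOut (avoids y)) λ {y} {z} eq →
      Fin.punchIn-injective x₀ y z (g-inj (Fin.punchOut-injective (avoids y) (avoids z) eq)))
  where
  avoids : ∀ y → fzero ≢ g (punchIn x₀ y)
  avoids y 0≡g = Fin.punchInᵢ≢i x₀ y (g-inj (trans (sym 0≡g) (sym gx₀≡0)))
... | no 0∉image =
  sorting-shift (λ x → sym (Fin.punchIn-punchOut (avoids x)))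
    (sort-injective (λ x → punchOut (avoids x)) λ {x} {y} eq →
      g-inj (Fin.punchOut-injective (avoids x) (avoids y) eq))
  where
  avoids : ∀ x → fzero ≢ g x
  avoids x 0≡gx = 0∉image (x , sym 0≡gx)

-- Lifting minors from an induced subgraph

charMat-induced : (e : InducedSub H G) → ∀ i j → charMat G (proj₁ e i) (proj₁ e j) ≡ charMat H i j
charMat-induced (f , f-inj , f-adj) i j =
  cong₂ (λ diagonal edge → if diagonal then tP else (if edge then -1P else 0P)) same-diagonal (f-adj i j)
  where
  -- does (m ℕ.≟ n) unfolds to m ≡ᵇ n.
  same-diagonal : (toℕ (f i) ≡ᵇ toℕ (f j)) ≡ (toℕ i ≡ᵇ toℕ j)
  same-diagonal = does-⇔
    (mk⇔ (cong toℕ ∘ f-inj ∘ Fin.toℕ-injective) (cong (toℕ ∘ f) ∘ Fin.toℕ-injective))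
    (toℕ (f i) ℕ.≟ toℕ (f j)) (toℕ i ℕ.≟ toℕ j)

minor-induced : (e : InducedSub H G) {r c : Fin k → Fin (n H)}
  (sr : Sorting (λ x → proj₁ e (r x))) (sc : Sorting (λ y → proj₁ e (c y))) →
  minor G k (sorted sr) (sorted sc) ≡ det k (λ x y → charMat H (r (order sr x)) (c (order sc y)))
minor-induced {H = H} {G = G} {k = k} e {r} {c} sr sc = det-cong k λ x y →
  trans (cong₂ (charMat G) (sorted≡g∘order sr x) (sorted≡g∘order sc y))
        (charMat-induced {H = H} {G = G} e (r (order sr x)) (c (order sc y)))

record Term (H : Graph) (k : ℕ) : Set where
  constructor term
  field
    rowVec colVec : Vec (Fin (n H)) k
    factor value : Poly

open Term

reordered : Term H k → Vec (Fin k) k → Vec (Fin k) k → Poly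
reordered {H = H} {k = k} t v w =
  (factor t ⊗ (sign v ⊗ sign w)) ⊗
  det k (λ x y → charMat H (lookup (rowVec t) (lookup v x)) (lookup (colVec t) (lookup w y)))

SignInvariant : Term H k → Set
SignInvariant {k = k} t =
  All (λ v → All (λ w → reordered t v w ≐ value t) (arrangements k)) (arrangements k)

Admissible : Term H k → Set
Admissible t = Unique (rowVec t) × Unique (colVec t) × SignInvariant t

admissible? : (t : Term H k) → Dec (Admissible t)
admissible? {k = k} t =
  unique? (rowVec t) ×-dec unique? (colVec t) ×-dec
  all? (λ v → all? (λ w → reordered t v w ≐? value t) (arrangements k)) (arrangements k)

Σvalue : List (Term H k) → Poly
Σvalue = foldr (λ t acc → value t ⊕ acc) 0P

record Certificate (H : Graph) (k : ℕ) : Set where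
  field
    terms : List (Term H k)
    admissible : All Admissible terms
    sums-to-one : Σvalue terms ≐ 1P

open Certificate

certify : (ts : List (Term H k)) → {True (all? admissible? ts ×-dec Σvalue ts ≐? 1P)} →
  Certificate H k
certify ts {valid} = record
  { terms = ts ; admissible = proj₁ (toWitness valid) ; sums-to-one = proj₂ (toWitness valid) }

∘lookup-injective : ∀ {A B : Set} {f : A → B} → Injective _≡_ _≡_ f →
  ∀ {u : Vec A k} → Unique u → Injective _≡_ _≡_ (f ∘ lookup u)
∘lookup-injective f-inj u-unique {x} {y} eq = lookup-injective u-unique x y (f-inj eq)

lift-term : (e : InducedSub H G) {t : Term H k} → Admissible t →
  Σ (MinorTerm G k) λ m → (coef m ⊗ minor G k (rows m) (cols m)) ≈P value t
lift-term {H = H} {G = G} {k = k} e@(f , f-inj , _) {t} (rows-unique , cols-unique , sign-invariant)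
  with sort-injective (f ∘ lookup (rowVec t)) (∘lookup-injective f-inj rows-unique)
     | sort-injective (f ∘ lookup (colVec t)) (∘lookup-injective f-inj cols-unique)
... | sr | sc with arrangement-of (order-injective sr) | arrangement-of (order-injective sc)
... | v , v∈ , v≗order | w , w∈ , w≗order =
  m , ≐⇒≈P {p = coef m ⊗ minor G k (rows m) (cols m)} {q = value t}
        (trans (cong trim lifted≡reordered) (All.lookup (All.lookup sign-invariant v∈) w∈))
  where
  m : MinorTerm G k
  m = record
    { rows = sorted sr ; cols = sorted sc
    ; rowsInc = sorted-increasing sr ; colsInc = sorted-increasing sc
    ; coef = factor t ⊗ (sign v ⊗ sign w)
    }
  lifted≡reordered : (coef m ⊗ minor G k (rows m) (cols m)) ≡ reordered t v w
  lifted≡reordered = cong (coef m ⊗_) (trans (minor-induced {H = H} {G = G} e sr sc) (det-cong k λ x y →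
    cong₂ (λ a b → charMat H (lookup (rowVec t) a) (lookup (colVec t) b))
          (sym (v≗order x)) (sym (w≗order y))))

lift-terms : InducedSub H G → {ts : List (Term H k)} → All Admissible ts →
  Σ (List (MinorTerm G k)) λ ms → combination G k ms ≈P Σvalue ts
lift-terms e [] = [] , λ i → refl
lift-terms {H = H} {G = G} e {t ∷ ts} (adm ∷ adms)
  with lift-term {H = H} {G = G} e {t} adm | lift-terms {H = H} {G = G} e adms
... | m , m≈t | ms , ms≈ts =
  m ∷ ms , ⊕-cong {p = coef m ⊗ minor G _ (rows m) (cols m)} {p′ = value t}
                  {q = combination G _ ms} {q′ = Σvalue ts} m≈t ms≈ts

certificate⇒trivial : InducedSub H G → Certificate H k → TrivialA G k
certificate⇒trivial {H = H} {G = G} {k = k} e c with lift-terms {H = H} {G = G} e (admissible c)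
... | ms , ms≈Σ =
  ms , ≈P-trans {p = combination G k ms} {q = Σvalue (terms c)} {r = 1P}
         ms≈Σ (≐⇒≈P {p = Σvalue (terms c)} {q = 1P} (sums-to-one c))

-- term rows columns factor (factor · minor); in each certificate the last polynomials add up to 1.
certificates : All (λ H → Certificate H 4) familyF
certificates =
    certify ( term (0 ∷ 1 ∷ 2 ∷ 4 ∷ []) (0 ∷ 1 ∷ 3 ∷ 4 ∷ []) (0 ∷ -1 ∷ []) (0 ∷ 0 ∷ 1 ∷ [])
            ∷ term (0 ∷ 1 ∷ 3 ∷ 4 ∷ []) (0 ∷ 2 ∷ 3 ∷ 4 ∷ []) (1 ∷ []) (1 ∷ 0 ∷ -1 ∷ []) ∷ [])
  ∷ certify ( term (0 ∷ 1 ∷ 2 ∷ 3 ∷ []) (0 ∷ 1 ∷ 3 ∷ 4 ∷ []) (0 ∷ 1 ∷ []) (0 ∷ 0 ∷ 2 ∷ [])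
            ∷ term (0 ∷ 1 ∷ 2 ∷ 4 ∷ []) (0 ∷ 2 ∷ 3 ∷ 4 ∷ []) (-1 ∷ []) (1 ∷ 0 ∷ -2 ∷ []) ∷ [])
  ∷ certify ( term (0 ∷ 1 ∷ 2 ∷ 3 ∷ []) (0 ∷ 1 ∷ 2 ∷ 4 ∷ []) (0 ∷ -1 ∷ []) (0 ∷ 1 ∷ 1 ∷ [])
            ∷ term (0 ∷ 1 ∷ 2 ∷ 3 ∷ []) (0 ∷ 1 ∷ 3 ∷ 4 ∷ []) (-1 ∷ []) (1 ∷ -1 ∷ -1 ∷ []) ∷ [])
  ∷ certify ( term (0 ∷ 1 ∷ 2 ∷ 3 ∷ []) (0 ∷ 1 ∷ 2 ∷ 4 ∷ []) (-2 ∷ []) (0 ∷ 2 ∷ 2 ∷ [])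
            ∷ term (0 ∷ 1 ∷ 2 ∷ 4 ∷ []) (0 ∷ 2 ∷ 3 ∷ 4 ∷ []) (-1 ∷ []) (1 ∷ -2 ∷ -2 ∷ []) ∷ [])
  ∷ certify ( term (0 ∷ 1 ∷ 2 ∷ 3 ∷ []) (1 ∷ 2 ∷ 3 ∷ 4 ∷ []) (1 ∷ []) (1 ∷ []) ∷ [])
  ∷ certify ( term (0 ∷ 1 ∷ 2 ∷ 3 ∷ []) (0 ∷ 1 ∷ 3 ∷ 4 ∷ []) (2 ∷ 0 ∷ -1 ∷ []) (2 ∷ 2 ∷ -1 ∷ -1 ∷ [])
            ∷ term (0 ∷ 1 ∷ 3 ∷ 4 ∷ []) (0 ∷ 2 ∷ 3 ∷ 4 ∷ []) (-1 ∷ []) (-1 ∷ -2 ∷ 1 ∷ 1 ∷ []) ∷ [])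
  ∷ certify ( term (0 ∷ 1 ∷ 2 ∷ 3 ∷ []) (0 ∷ 1 ∷ 3 ∷ 4 ∷ []) (-2 ∷ 1 ∷ -3 ∷ []) (0 ∷ -6 ∷ -1 ∷ -7 ∷ -6 ∷ [])
            ∷ term (0 ∷ 1 ∷ 2 ∷ 4 ∷ []) (0 ∷ 1 ∷ 3 ∷ 4 ∷ []) (-1 ∷ -6 ∷ []) (1 ∷ 6 ∷ 1 ∷ 7 ∷ 6 ∷ []) ∷ [])
  ∷ certify ( term (0 ∷ 1 ∷ 2 ∷ 3 ∷ []) (0 ∷ 2 ∷ 3 ∷ 4 ∷ []) (3 ∷ -3 ∷ -2 ∷ []) (0 ∷ -3 ∷ 0 ∷ 5 ∷ 2 ∷ [])
            ∷ term (0 ∷ 2 ∷ 3 ∷ 4 ∷ []) (1 ∷ 2 ∷ 3 ∷ 4 ∷ []) (1 ∷ 2 ∷ []) (1 ∷ 3 ∷ 0 ∷ -5 ∷ -2 ∷ []) ∷ [])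
  ∷ certify ( term (0 ∷ 1 ∷ 3 ∷ 4 ∷ []) (0 ∷ 2 ∷ 3 ∷ 5 ∷ []) (0 ∷ 1 ∷ []) (0 ∷ 0 ∷ 1 ∷ [])
            ∷ term (0 ∷ 1 ∷ 2 ∷ 3 ∷ []) (0 ∷ 1 ∷ 2 ∷ 4 ∷ []) (1 ∷ []) (1 ∷ 0 ∷ -1 ∷ []) ∷ [])
  ∷ certify ( term (0 ∷ 1 ∷ 2 ∷ 4 ∷ []) (0 ∷ 3 ∷ 4 ∷ 5 ∷ []) (1 ∷ []) (0 ∷ 0 ∷ 1 ∷ [])
            ∷ term (0 ∷ 2 ∷ 3 ∷ 4 ∷ []) (0 ∷ 2 ∷ 3 ∷ 5 ∷ []) (1 ∷ []) (1 ∷ 0 ∷ -1 ∷ []) ∷ [])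
  ∷ certify ( term (0 ∷ 1 ∷ 2 ∷ 3 ∷ []) (0 ∷ 1 ∷ 4 ∷ 5 ∷ []) (-7 ∷ -6 ∷ []) (0 ∷ 0 ∷ 7 ∷ 6 ∷ [])
            ∷ term (0 ∷ 3 ∷ 4 ∷ 5 ∷ []) (1 ∷ 3 ∷ 4 ∷ 5 ∷ []) (1 ∷ 2 ∷ []) (1 ∷ 0 ∷ -7 ∷ -6 ∷ []) ∷ [])
  ∷ certify ( term (0 ∷ 1 ∷ 3 ∷ 5 ∷ []) (0 ∷ 2 ∷ 4 ∷ 5 ∷ []) (0 ∷ 1 ∷ []) (0 ∷ 0 ∷ 1 ∷ [])
            ∷ term (0 ∷ 1 ∷ 3 ∷ 4 ∷ []) (2 ∷ 3 ∷ 4 ∷ 5 ∷ []) (1 ∷ []) (1 ∷ 0 ∷ -1 ∷ []) ∷ [])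
  ∷ certify ( term (0 ∷ 1 ∷ 3 ∷ 5 ∷ []) (0 ∷ 2 ∷ 4 ∷ 6 ∷ []) (-1 ∷ -1 ∷ []) (1 ∷ 2 ∷ 1 ∷ [])
            ∷ term (0 ∷ 3 ∷ 4 ∷ 5 ∷ []) (1 ∷ 3 ∷ 4 ∷ 6 ∷ []) (1 ∷ []) (0 ∷ -2 ∷ -1 ∷ []) ∷ [])
  ∷ certify ( term (0 ∷ 4 ∷ 5 ∷ 6 ∷ []) (0 ∷ 4 ∷ 5 ∷ 7 ∷ []) (-3 ∷ -2 ∷ []) (0 ∷ 0 ∷ 3 ∷ 2 ∷ [])
            ∷ term (0 ∷ 1 ∷ 2 ∷ 4 ∷ []) (0 ∷ 1 ∷ 3 ∷ 5 ∷ []) (-1 ∷ 2 ∷ []) (1 ∷ 0 ∷ -3 ∷ -2 ∷ []) ∷ [])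
  ∷ []

mainTheorem9 : (G : Graph) → Connected G → InC≤ 3 G →
    ∀ H → H ∈ familyF → ¬ InducedSub H G
mainTheorem9 G _ γ≤3 H H∈𝓕 H↪G =
  γ≤3 4 (ℕ.n<1+n 3) (certificate⇒trivial H↪G (All.lookup certificates H∈𝓕))
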